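{- Let $k$ be a positive integer, $u : \mathbb{Z}^k \to \mathbb{Z}$ a function and $v : \mathbb{Z}^k \to \mathbb{Z}$ a moderation of $u$. Let $\mathcal{B}$ be a subset of $\mathbb{Z}^k$ admitting a minimal complement $M$ in $\mathbb{Z}^k$. Then the subset $$M_v := \{(x, v(x)) : x \in M\}$$ of $\mathbb{Z}^{k+1}$ is a minimal complement in $\mathbb{Z}^{k+1}$ of every subset $X \subseteq \mathbb{Z}^{k+1}$ satisfying $$\mathcal{B} \times \mathbb{Z} \subseteq X \subseteq (\mathcal{B} \times \mathbb{Z}) \cup \bigcup_{x \in \mathbb{Z}^k \setminus \mathcal{B}} \big(\{x\} \times \{n \in \mathbb{Z} : n < u(x)\}\big).$$
   Context: For an abelian group $G$ and nonempty subsets $W, W' \subseteq G$, $W'$ is a complement of $W$ in $G$ if $W + W' = G$; it is a minimal complement if moreover $W + (W' \setminus \{w'\}) \neq G$ for every $w' \in W'$. Given $u : \mathbb{Z}^k \to \mathbb{Z}$, a function $v : \mathbb{Z}^k \to \mathbb{Z}$ is a moderation of $u$ if for each $x_0 \in \mathbb{Z}^k$ the function $x \mapsto u(x) + v(x_0 - x)$ on $\mathbb{Z}^k$ is bounded above. -}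

module Defs where

open import Level using (Level; _⊔_; suc)
open import Data.Nat as ℕ using (ℕ)
open import Data.Fin using (Fin)
open import Data.Integer using (ℤ; _+_; _<_; _≤_)
open import Data.Vec using (Vec; _∷ʳ_; zipWith; initLast)
open import Data.Product using (Σ; ∃; _×_; _,_)
open import Relation.Nullary using (¬_)
open import Relation.Binary.PropositionalEquality using (_≡_)

ℤ^ : ℕ → Set
ℤ^ n = Vec ℤ n

_⊕_ : ∀ {n} → ℤ^ n → ℤ^ n → ℤ^ n
_⊕_ = zipWith _+_


Subset : ℕ → Set₁
Subset n = ℤ^ n → Set

_⊆_ : ∀ {n} → Subset n → Subset n → Set
A ⊆ B = ∀ x → A x → B x

Nonempty : ∀ {n} → Subset n → Set
Nonempty {n} A = Σ (ℤ^ n) A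

SumsetIsAll : ∀ {n} → Subset n → Subset n → Set
SumsetIsAll {n} W W' =
  ∀ (g : ℤ^ n) → Σ (ℤ^ n) λ w → Σ (ℤ^ n) λ w' → W w × W' w' × g ≡ (w ⊕ w')

IsComplement : ∀ {n} → Subset n → Subset n → Set
IsComplement W W' = Nonempty W × Nonempty W' × SumsetIsAll W W'

remove : ∀ {n} → Subset n → ℤ^ n → Subset n
remove W' w' y = W' y × ¬ (y ≡ w')

IsMinimalComplement : ∀ {n} → Subset n → Subset n → Set
IsMinimalComplement W W' =
  IsComplement W W' × (∀ w' → W' w' → ¬ SumsetIsAll W (remove W' w'))

IsModeration : ∀ {k} → (ℤ^ k → ℤ) → (ℤ^ k → ℤ) → Set
IsModeration {k} u v =
  ∀ (x₀ : ℤ^ k) → Σ ℤ λ C → ∀ (x : ℤ^ k) →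
    (u x + v (zipWith Data.Integer._-_ x₀ x)) ≤ C

-- ℤ^{k+1} = ℤ^k × ℤ via (x, n) ↦ x ∷ʳ n (append last coordinate)
-- M_v = {(x, v x) : x ∈ M}
graphOver : ∀ {k} → Subset k → (ℤ^ k → ℤ) → Subset (ℕ.suc k)
graphOver {k} M v p = Σ (ℤ^ k) λ x → M x × p ≡ (x ∷ʳ v x)

cylinder : ∀ {k} → Subset k → Subset (ℕ.suc k)
cylinder {k} B p = Σ (ℤ^ k) λ x → Σ ℤ λ n → B x × p ≡ (x ∷ʳ n)

upperBound : ∀ {k} → Subset k → (ℤ^ k → ℤ) → Subset (ℕ.suc k)
upperBound {k} B u p = Σ (ℤ^ k) λ x → Σ ℤ λ n → p ≡ (x ∷ʳ n) ×
  (B x Data.Sum.⊎ (¬ B x × n < u x))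
  where import Data.Sum

module Submission where

-- The proof
-- has two independent halves.
--   * Lifting (no hypothesis on v): if B + M' = ℤ^k and B × ℤ ⊆ X, then
--     X + M'_v = ℤ^{k+1}; write (y, n) = (b, n - v m) + (m, v m) for y = b + m.
--   * Descent (uses the moderation and X ⊆ upperBound B u): if
--     X + M'_v = ℤ^{k+1} then B + M' = ℤ^k.  Given y, let C bound
--     x ↦ u x + v (y - x) and decompose (y, C) = (x, t) + (m, v m).  If x ∉ B
--     then t < u x, so C = t + v m < u x + v (y - x) ≤ C, absurd; hence x ∈ B.
-- Lifting with M' = M gives that M_v is a complement of X.  If M_v minus the
-- point (m₁, v m₁) were still a complement, it is contained in the graph of
-- M ∖ {m₁}, so descent would make M ∖ {m₁} a complement of B, contradicting
-- minimality of M.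

open import Defs
open import Data.Nat using (ℕ; suc; _≥_)
open import Data.Integer using (ℤ; 0ℤ; _+_; _-_; _<_; _≤_)
open import Data.Integer.Properties
  using (+-0-abelianGroup; +-monoˡ-<; <-≤-trans; <-irrefl)
open import Algebra.Properties.AbelianGroup +-0-abelianGroup
  using (xyx⁻¹≈y; //-rightDividesˡ)
open import Data.Vec using ([]; _∷_; _∷ʳ_; zipWith; initLast)
open import Data.Vec.Properties using (∷ʳ-injective)
open import Data.Product using (_×_; _,_)
open import Data.Sum using (_⊎_; inj₁; inj₂)
open import Data.Empty using (⊥-elim)
open import Relation.Nullary using (¬_)
open import Relation.Binary.PropositionalEquality
  using (_≡_; refl; sym; trans; cong; cong₂; subst)

⊕-∷ʳ : ∀ {k} (x y : ℤ^ k) (a b : ℤ) → (x ∷ʳ a) ⊕ (y ∷ʳ b) ≡ (x ⊕ y) ∷ʳ (a + b)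
⊕-∷ʳ []       []       a b = refl
⊕-∷ʳ (x ∷ xs) (y ∷ ys) a b = cong ((x + y) ∷_) (⊕-∷ʳ xs ys a b)

⊕-minusˡ : ∀ {k} (x m : ℤ^ k) → zipWith _-_ (x ⊕ m) x ≡ m
⊕-minusˡ []       []       = refl
⊕-minusˡ (x ∷ xs) (m ∷ ms) = cong₂ _∷_ (xyx⁻¹≈y x m) (⊕-minusˡ xs ms)

sumsetIsAll-monoʳ : ∀ {n} {W W' W'' : Subset n} →
  W' ⊆ W'' → SumsetIsAll W W' → SumsetIsAll W W''
sumsetIsAll-monoʳ W'⊆W'' sum g with sum g
... | w , w' , Ww , W'w' , g≡ = w , w' , Ww , W'⊆W'' w' W'w' , g≡

remove-graphOver : ∀ {k} (M : Subset k) (v : ℤ^ k → ℤ) (m₁ : ℤ^ k) →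
  remove (graphOver M v) (m₁ ∷ʳ v m₁) ⊆ graphOver (remove M m₁) v
remove-graphOver M v m₁ .(m ∷ʳ v m) ((m , Mm , refl) , ≢m₁) =
  m , (Mm , λ m≡m₁ → ≢m₁ (cong (λ z → z ∷ʳ v z) m≡m₁)) , refl

lift-complement : ∀ {k} (v : ℤ^ k → ℤ) (B M' : Subset k) (X : Subset (suc k)) →
  cylinder B ⊆ X → SumsetIsAll B M' → SumsetIsAll X (graphOver M' v)
lift-complement v B M' X B×ℤ⊆X sumBM' g with initLast g
... | y , n , refl with sumBM' y
... | b , m , Bb , M'm , y≡b⊕m =
  b ∷ʳ (n - v m) , m ∷ʳ v m ,
  B×ℤ⊆X _ (b , n - v m , Bb , refl) , (m , M'm , refl) ,
  trans (cong₂ _∷ʳ_ y≡b⊕m (sym (//-rightDividesˡ (v m) n)))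
        (sym (⊕-∷ʳ b m (n - v m) (v m)))

not-below-moderation : ∀ {k} (u v : ℤ^ k → ℤ) (x m y : ℤ^ k) (t C : ℤ) →
  y ≡ x ⊕ m → C ≡ t + v m → u x + v (zipWith _-_ y x) ≤ C → ¬ (t < u x)
not-below-moderation u v x m .(x ⊕ m) t C refl C≡ bound t<ux =
  <-irrefl (sym C≡) (<-≤-trans (+-monoˡ-< (v m) t<ux) ux+vm≤C)
  where
  ux+vm≤C : u x + v m ≤ C
  ux+vm≤C = subst (λ z → u x + v z ≤ C) (⊕-minusˡ x m) bound

descend-complement : ∀ {k} (u v : ℤ^ k → ℤ) → IsModeration u v →
  (B M' : Subset k) (X : Subset (suc k)) → X ⊆ upperBound B u →
  SumsetIsAll X (graphOver M' v) → SumsetIsAll B M'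
descend-complement u v moderation B M' X X⊆upper sumXM'v y
  with moderation y
... | C , bound with sumXM'v (y ∷ʳ C)
... | p , .(m ∷ʳ v m) , Xp , (m , M'm , refl) , yC≡ with X⊆upper p Xp
... | x , t , refl , inB⊎below with ∷ʳ-injective y (x ⊕ m) (trans yC≡ (⊕-∷ʳ x m t (v m)))
... | y≡x⊕m , C≡t+vm = x , m , Bx inB⊎below , M'm , y≡x⊕m
  where
  Bx : B x ⊎ (¬ B x × t < u x) → B x
  Bx (inj₁ bx)          = bx
  Bx (inj₂ (_ , t<ux)) =
    ⊥-elim (not-below-moderation u v x m y t C y≡x⊕m C≡t+vm (bound x) t<ux)

proposition4p4 : (k : ℕ) → k ≥ 1 → (u v : ℤ^ k → ℤ) → IsModeration u v →
    (B M : Subset k) → IsMinimalComplement B M →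
    (X : Subset (suc k)) → cylinder B ⊆ X → X ⊆ upperBound B u →
    IsMinimalComplement X (graphOver M v)
proposition4p4 k _ u v moderation B M (((b₀ , Bb₀) , (m₀ , Mm₀) , sumBM) , minimalM)
               X B×ℤ⊆X X⊆upper =
  ((b₀ ∷ʳ 0ℤ , B×ℤ⊆X _ (b₀ , 0ℤ , Bb₀ , refl)) ,
   (m₀ ∷ʳ v m₀ , m₀ , Mm₀ , refl) ,
   lift-complement v B M X B×ℤ⊆X sumBM) ,
  minimal
  where
  minimal : ∀ w' → graphOver M v w' → ¬ SumsetIsAll X (remove (graphOver M v) w')
  minimal .(m₁ ∷ʳ v m₁) (m₁ , Mm₁ , refl) sumWithout =
    minimalM m₁ Mm₁
      (descend-complement u v moderation B (remove M m₁) X X⊆upper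
        (sumsetIsAll-monoʳ (remove-graphOver M v m₁) sumWithout))
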